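{- Let $\alpha\in(0,1]$ and let $G$ be a graph on $n$ vertices with at least $\alpha\binom{n}{2}$ edges. If $G$ does not contain $K_{2,2}$ as an induced subgraph, then $\omega(G)\geq (1-\sqrt{1-\alpha})^2\,n$.
   Context: $\omega(G)$ denotes the maximum number of vertices of a clique (complete subgraph) in $G$. $K_{2,2}$ is the complete bipartite graph with two vertices on each side (a 4-cycle); $G$ contains it as an induced subgraph if there are four vertices of $G$ whose induced subgraph is a 4-cycle.
   Formalization: The edge-density parameter α is rational. -}

module Defs where

open import Data.Bool using (Bool; true; false)
open import Data.Nat using (ℕ; _<?_)
open import Data.Fin using (Fin; toℕ)
open import Data.Fin.Properties using () renaming (_≟_ to _≟ᶠ_)
open import Data.Bool.Properties using () renaming (_≟_ to _≟ᵇ_)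
open import Data.List using (List; length; filter; cartesianProduct; allFin)
open import Data.List.Relation.Unary.Unique.Propositional using (Unique)
open import Data.List.Relation.Unary.AllPairs using (AllPairs)
open import Data.Product using (_×_; _,_; proj₁; proj₂; Σ)
open import Relation.Nullary using (¬_)
open import Relation.Nullary.Decidable using (_×-dec_)
open import Relation.Binary.PropositionalEquality using (_≡_)
open import Data.Integer using (+_)
open import Data.Rational using (ℚ; _/_)

record Graph (n : ℕ) : Set where
  field
    adj   : Fin n → Fin n → Bool
    sym   : ∀ i j → adj i j ≡ adj j i
    irrefl : ∀ i → adj i i ≡ false

open Graph public

Adj : ∀ {n} → Graph n → Fin n → Fin n → Set
Adj G i j = adj G i j ≡ true

edgeCount : ∀ {n} → Graph n → ℕ
edgeCount {n} G =
  length (filter (λ p → (toℕ (proj₁ p) <? toℕ (proj₂ p)) ×-dec (adj G (proj₁ p) (proj₂ p) ≟ᵇ true))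
                 (cartesianProduct (allFin n) (allFin n)))

IsClique : ∀ {n} → Graph n → List (Fin n) → Set
IsClique G xs = Unique xs × AllPairs (Adj G) xs

-- G contains K_{2,2} (the 4-cycle a-b-c-d-a) as an induced subgraph:
-- four distinct vertices with a~b, b~c, c~d, d~a and a≁c, b≁d.
-- (Distinctness of adjacent pairs follows from irreflexivity.)
HasInducedC4 : ∀ {n} → Graph n → Set
HasInducedC4 {n} G =
  Σ (Fin n) λ a → Σ (Fin n) λ b → Σ (Fin n) λ c → Σ (Fin n) λ d →
    ¬ (a ≡ c) × ¬ (b ≡ d) ×
    Adj G a b × Adj G b c × Adj G c d × Adj G d a ×
    ¬ Adj G a c × ¬ Adj G b d

ℕ→ℚ : ℕ → ℚ
ℕ→ℚ k = + k / 1

module Submission where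

open import Defs renaming (sym to adj-sym; irrefl to adj-irrefl)
open import Data.Nat using (ℕ; zero; suc)
open import Data.List using (length)
open import Data.Product using (Σ; _×_)
open import Relation.Nullary using (¬_)

-- By induction on k, every vertex set S without a clique of size k + 1 satisfies
-- 2e(S) ≤ (|S| - 1)(k(λ - 1) + |S|/λ) for all λ ≥ 1: a neighbourhood N(w) has no clique of size k
-- and, as there is no induced C4, the common neighbourhood of two non-adjacent vertices is a clique,
-- so they have fewer than k common neighbours. Counting the non-adjacent pairs inside all
-- neighbourhoods in two ways, with the induction hypothesis for each N(w) at the same λ and deg(w)²
-- replaced by a suitable tangent line, reduces the induction step to an explicit polynomial
-- inequality. Taking λ = √(n/k) gives 2e ≤ (n - 1)(2√(kn) - k), that is (αn + k)² ≤ 4kn.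

module Finite where

  open import Data.Bool using (Bool; true; false; _∧_)
  open import Data.Bool.Properties using () renaming (_≟_ to _≟ᵇ_)
  open import Data.Nat using (ℕ; zero; suc; _+_; _*_; _≤_; _≤?_; z≤n)
  open import Data.Nat.Properties
    using (+-identityʳ; *-identityʳ; *-distribˡ-+; *-assoc; +-mono-≤; +-monoˡ-≤; ≤-trans; m≤m+n; m≤n+m; ≰⇒>;
           +-*-semiring; module ≤-Reasoning)
  open import Data.Nat.Tactic.RingSolver using (solve-∀)
  open import Data.Fin using (Fin; zero; suc)
  open import Data.Fin.Properties using (_≟_; pigeonhole; <-irrefl)
  open import Data.List using (List; length; lookup; filter; tabulate; cartesianProduct; map; _++_)
  open import Data.List.Properties using (filter-++; length-++; map-tabulate)
  open import Data.List.Membership.Propositional.Properties using (∈-lookup)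
  open import Data.List.Relation.Unary.All as All using ()
  open import Data.List.Relation.Unary.AllPairs using (_∷_)
  open import Data.List.Relation.Unary.Unique.Propositional using (Unique)
  open import Data.Product using (_×_; _,_)
  open import Data.Sum using (_⊎_; inj₁; inj₂)
  open import Data.Empty using (⊥-elim)
  open import Function using (_∘_)
  open import Relation.Nullary using (does; yes; no)
  open import Relation.Unary using (Pred; Decidable)
  open import Relation.Binary.PropositionalEquality
  open import Algebra.Properties.Semiring.Sum +-*-semiring public
    using (sum-syntax; sum-cong-≗; ∑-distrib-+; ∑-comm)
  open import Algebra.Properties.Semiring.Sum +-*-semiring
    using (sum-replicate-zero; *-distribˡ-sum; *-distribʳ-sum)

  𝟙 : Bool → ℕ
  𝟙 true = 1
  𝟙 false = 0

  𝟙-∧ : ∀ a b → 𝟙 (a ∧ b) ≡ 𝟙 a * 𝟙 b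
  𝟙-∧ true b = sym (+-identityʳ (𝟙 b))
  𝟙-∧ false b = refl

  does-≟-true : ∀ b → does (b ≟ᵇ true) ≡ b
  does-≟-true true = refl
  does-≟-true false = refl

  ∑-mono-≤ : ∀ {n} {f g : Fin n → ℕ} → (∀ i → f i ≤ g i) → ∑[ i < n ] f i ≤ ∑[ i < n ] g i
  ∑-mono-≤ {zero} f≤g = z≤n
  ∑-mono-≤ {suc n} f≤g = +-mono-≤ (f≤g zero) (∑-mono-≤ (f≤g ∘ suc))

  term≤∑ : ∀ {n} (f : Fin n → ℕ) i → f i ≤ ∑[ j < n ] f j
  term≤∑ f zero = m≤m+n (f zero) _
  term≤∑ f (suc i) = ≤-trans (term≤∑ (f ∘ suc) i) (m≤n+m _ (f zero))

  ∑-sift : ∀ {n} (x : Fin n) (f : Fin n → ℕ) → ∑[ y < n ] (𝟙 (does (x ≟ y)) * f y) ≡ f x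
  ∑-sift {suc n} zero f = trans (cong₂ _+_ (+-identityʳ (f zero)) (sum-replicate-zero n)) (+-identityʳ (f zero))
  ∑-sift {suc n} (suc x) f = ∑-sift x (f ∘ suc)

  ∑∈ : ∀ {n} → (Fin n → Bool) → (Fin n → ℕ) → ℕ
  ∑∈ {n} S f = ∑[ v < n ] (𝟙 (S v) * f v)

  infixl 10 ∑∈
  syntax ∑∈ S (λ v → e) = ∑[ v ∈ S ] e

  module _ {n} (S : Fin n → Bool) where

    ∑∈-cong : {f g : Fin n → ℕ} → (∀ v → S v ≡ true → f v ≡ g v) → ∑[ v ∈ S ] f v ≡ ∑[ v ∈ S ] g v
    ∑∈-cong f≡g = sum-cong-≗ pointwise
      where
      pointwise : ∀ v → 𝟙 (S v) * _ ≡ 𝟙 (S v) * _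
      pointwise v with S v in Sv
      ... | true = cong (_+ 0) (f≡g v Sv)
      ... | false = refl

    ∑∈-mono-≤ : {f g : Fin n → ℕ} → (∀ v → S v ≡ true → f v ≤ g v) → ∑[ v ∈ S ] f v ≤ ∑[ v ∈ S ] g v
    ∑∈-mono-≤ f≤g = ∑-mono-≤ pointwise
      where
      pointwise : ∀ v → 𝟙 (S v) * _ ≤ 𝟙 (S v) * _
      pointwise v with S v in Sv
      ... | true = +-monoˡ-≤ 0 (f≤g v Sv)
      ... | false = z≤n

    ∑∈-distrib-+ : (f g : Fin n → ℕ) → ∑[ v ∈ S ] (f v + g v) ≡ ∑[ v ∈ S ] f v + ∑[ v ∈ S ] g v
    ∑∈-distrib-+ f g = trans (sum-cong-≗ (λ v → *-distribˡ-+ (𝟙 (S v)) (f v) (g v)))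
                             (∑-distrib-+ (λ v → 𝟙 (S v) * f v) (λ v → 𝟙 (S v) * g v))

    ∑∈-*ˡ : (c : ℕ) (f : Fin n → ℕ) → ∑[ v ∈ S ] (c * f v) ≡ c * ∑[ v ∈ S ] f v
    ∑∈-*ˡ c f = trans (sum-cong-≗ (λ v → swap (𝟙 (S v)) c (f v))) (sym (*-distribˡ-sum c (λ v → 𝟙 (S v) * f v)))
      where
      swap : ∀ a b c → a * (b * c) ≡ b * (a * c)
      swap = solve-∀

    size : ℕ
    size = ∑[ v ∈ S ] 1

    ∑∈-const : (c : ℕ) → ∑[ v ∈ S ] c ≡ size * c
    ∑∈-const c = trans (sum-cong-≗ (λ v → cong (_* c) (sym (*-identityʳ (𝟙 (S v))))))
                       (sym (*-distribʳ-sum c (λ v → 𝟙 (S v) * 1)))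

    ∑∈-affine-≤ : ∀ {a b c d e} (f g : Fin n → ℕ) → (∀ v → S v ≡ true → d * f v + e ≤ a * g v + b * f v + c) →
      d * ∑[ v ∈ S ] f v + size * e ≤ a * ∑[ v ∈ S ] g v + b * ∑[ v ∈ S ] f v + size * c
    ∑∈-affine-≤ {a} {b} {c} {d} {e} f g pointwise = begin
      d * ∑[ v ∈ S ] f v + size * e                            ≡⟨ cong₂ _+_ (∑∈-*ˡ d f) (∑∈-const e) ⟨
      ∑[ v ∈ S ] (d * f v) + ∑[ v ∈ S ] e                      ≡⟨ ∑∈-distrib-+ _ _ ⟨
      ∑[ v ∈ S ] (d * f v + e)                                 ≤⟨ ∑∈-mono-≤ pointwise ⟩
      ∑[ v ∈ S ] (a * g v + b * f v + c)                       ≡⟨ trans (∑∈-distrib-+ _ _) (cong (_+ ∑[ v ∈ S ] c) (∑∈-distrib-+ _ _)) ⟩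
      ∑[ v ∈ S ] (a * g v) + ∑[ v ∈ S ] (b * f v) + ∑[ v ∈ S ] c
        ≡⟨ cong₂ _+_ (cong₂ _+_ (∑∈-*ˡ a g) (∑∈-*ˡ b f)) (∑∈-const c) ⟩
      a * ∑[ v ∈ S ] g v + b * ∑[ v ∈ S ] f v + size * c       ∎
      where open ≤-Reasoning

  full : ∀ {n} → Fin n → Bool
  full _ = true

  size-full : ∀ n → size {n} full ≡ n
  size-full zero = refl
  size-full (suc n) = cong suc (size-full n)

  ∑∈-comm : ∀ {n} (S T : Fin n → Bool) (f : Fin n → Fin n → ℕ) →
    ∑[ x ∈ S ] ∑[ y ∈ T ] f x y ≡ ∑[ y ∈ T ] ∑[ x ∈ S ] f x y
  ∑∈-comm {n} S T f = begin
    ∑[ x < n ] (𝟙 (S x) * ∑[ y < n ] (𝟙 (T y) * f x y))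
      ≡⟨ sum-cong-≗ (λ x → *-distribˡ-sum (𝟙 (S x)) (λ y → 𝟙 (T y) * f x y)) ⟩
    ∑[ x < n ] ∑[ y < n ] (𝟙 (S x) * (𝟙 (T y) * f x y))
      ≡⟨ ∑-comm (λ x y → 𝟙 (S x) * (𝟙 (T y) * f x y)) ⟩
    ∑[ y < n ] ∑[ x < n ] (𝟙 (S x) * (𝟙 (T y) * f x y))
      ≡⟨ sum-cong-≗ (λ y → sum-cong-≗ (λ x → swap (𝟙 (S x)) (𝟙 (T y)) (f x y))) ⟩
    ∑[ y < n ] ∑[ x < n ] (𝟙 (T y) * (𝟙 (S x) * f x y))
      ≡⟨ sum-cong-≗ (λ y → *-distribˡ-sum (𝟙 (T y)) (λ x → 𝟙 (S x) * f x y)) ⟨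
    ∑[ y < n ] (𝟙 (T y) * ∑[ x < n ] (𝟙 (S x) * f x y))  ∎
    where
    open ≡-Reasoning
    swap : ∀ a b c → a * (b * c) ≡ b * (a * c)
    swap = solve-∀

  _∩_ : ∀ {n} → (Fin n → Bool) → (Fin n → Bool) → (Fin n → Bool)
  (S ∩ P) v = S v ∧ P v

  ∑∈-∩ : ∀ {n} (S P : Fin n → Bool) (f : Fin n → ℕ) → ∑[ v ∈ S ∩ P ] f v ≡ ∑[ v ∈ S ] (𝟙 (P v) * f v)
  ∑∈-∩ S P f = sum-cong-≗ (λ v → trans (cong (_* f v) (𝟙-∧ (S v) (P v))) (*-assoc (𝟙 (S v)) (𝟙 (P v)) (f v)))

  length-filter-tabulate : ∀ {a p} {A : Set a} {P : Pred A p} (P? : Decidable P) {n} (f : Fin n → A) →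
    length (filter P? (tabulate f)) ≡ ∑[ i < n ] 𝟙 (does (P? (f i)))
  length-filter-tabulate P? {zero} f = refl
  length-filter-tabulate P? {suc n} f with does (P? (f zero))
  ... | true = cong suc (length-filter-tabulate P? (f ∘ suc))
  ... | false = length-filter-tabulate P? (f ∘ suc)

  length-filter-cartesianProduct : ∀ {a b p} {A : Set a} {B : Set b} {P : Pred (A × B) p} (P? : Decidable P)
    {m n} (f : Fin m → A) (g : Fin n → B) →
    length (filter P? (cartesianProduct (tabulate f) (tabulate g))) ≡ ∑[ i < m ] ∑[ j < n ] 𝟙 (does (P? (f i , g j)))
  length-filter-cartesianProduct P? {zero} f g = refl
  length-filter-cartesianProduct P? {suc m} {n} f g = begin
    length (filter P? (row ++ rest))                  ≡⟨ cong length (filter-++ P? row rest) ⟩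
    length (filter P? row ++ filter P? rest)          ≡⟨ length-++ (filter P? row) ⟩
    length (filter P? row) + length (filter P? rest)
      ≡⟨ cong₂ _+_ (trans (cong (length ∘ filter P?) (map-tabulate g (f zero ,_))) (length-filter-tabulate P? (λ j → f zero , g j)))
                   (length-filter-cartesianProduct P? (f ∘ suc) g) ⟩
    ∑[ j < n ] 𝟙 (does (P? (f zero , g j))) + ∑[ i < m ] ∑[ j < n ] 𝟙 (does (P? (f (suc i) , g j))) ∎
    where
    open ≡-Reasoning
    row = map (f zero ,_) (tabulate g)
    rest = cartesianProduct (tabulate (f ∘ suc)) (tabulate g)

  sequence-⊎ : ∀ {n} {P : Fin n → Set} {C : Set} → (∀ i → P i ⊎ C) → (∀ i → P i) ⊎ C
  sequence-⊎ {zero} _ = inj₁ (λ ())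
  sequence-⊎ {suc n} f with f zero | sequence-⊎ (f ∘ suc)
  ... | inj₂ c | _ = inj₂ c
  ... | inj₁ _ | inj₂ c = inj₂ c
  ... | inj₁ p | inj₁ ps = inj₁ λ { zero → p ; (suc i) → ps i }

  lookup-injective : ∀ {A : Set} {xs : List A} → Unique xs → ∀ i j → lookup xs i ≡ lookup xs j → i ≡ j
  lookup-injective (_ ∷ _) zero zero _ = refl
  lookup-injective (x∉xs ∷ _) zero (suc j) x≡ = ⊥-elim (All.lookup x∉xs (∈-lookup j) x≡)
  lookup-injective (x∉xs ∷ _) (suc i) zero ≡x = ⊥-elim (All.lookup x∉xs (∈-lookup i) (sym ≡x))
  lookup-injective (_ ∷ unique) (suc i) (suc j) eq = cong suc (lookup-injective unique i j eq)

  unique-length≤n : ∀ {n} {xs : List (Fin n)} → Unique xs → length xs ≤ n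
  unique-length≤n {n} {xs} unique with length xs ≤? n
  ... | yes ≤n = ≤n
  ... | no ≰n with i , j , i<j , same ← pigeonhole (≰⇒> ≰n) (lookup xs)
    = ⊥-elim (<-irrefl (lookup-injective unique i j same) i<j)

module Arithmetic where

  open import Data.Nat
  open import Data.Nat.Properties
  open import Data.Nat.Tactic.RingSolver using (solve-∀)
  open import Data.Empty using (⊥-elim)
  open import Relation.Nullary using (yes; no)
  open import Relation.Binary.PropositionalEquality

  2*m*n≤m²+n² : ∀ m n → 2 * (m * n) ≤ m * m + n * n
  2*m*n≤m²+n² zero n = z≤n
  2*m*n≤m²+n² m@(suc _) zero = subst (_≤ m * m + 0) (cong (2 *_) (sym (*-zeroʳ m))) z≤n
  2*m*n≤m²+n² (suc m) (suc n) = begin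
    2 * (suc m * suc n)             ≡⟨ lhs m n ⟩
    2 * (m * n) + 2 * (m + n + 1)   ≤⟨ +-monoˡ-≤ _ (2*m*n≤m²+n² m n) ⟩
    m * m + n * n + 2 * (m + n + 1) ≡⟨ rhs m n ⟩
    suc m * suc m + suc n * suc n   ∎
    where
    open ≤-Reasoning
    lhs : ∀ m n → 2 * (suc m * suc n) ≡ 2 * (m * n) + 2 * (m + n + 1)
    lhs = solve-∀
    rhs : ∀ m n → m * m + n * n + 2 * (m + n + 1) ≡ suc m * suc m + suc n * suc n
    rhs = solve-∀

  distinct-pairs : ∀ N X Y → N * N ≡ X + Y + N → X + Y ≡ N * (N ∸ 1)
  distinct-pairs zero X Y 0≡ = trans (sym (+-identityʳ (X + Y))) (sym 0≡)
  distinct-pairs (suc M) X Y N²≡ =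
    +-cancelʳ-≡ (suc M) _ _ (trans (sym N²≡) (trans (*-suc (suc M) M) (+-comm (suc M) (suc M * M))))

  -- For a vertex of degree D = suc d whose neighbourhood has t ordered adjacent and P ordered non-adjacent
  -- pairs: with λ = (q + U)/q the hypothesis reads t ≤ (D - 1)(k(λ - 1) + D/λ) and the conclusion
  -- λP ≥ (λ - 1)(D - 1)(D - kλ).
  wedge-bound : ∀ k q U d t P → suc d * suc d ≡ t + P + suc d →
    t * (q + U) * q ≤ d * (k * U * (q + U) + suc d * q * q) →
    U * (q * (suc d * suc d) + k * (q + U)) ≤ (q + U) * q * P + U * (q + k * (q + U)) * suc d
  wedge-bound k q U d t P square t-bound =
    +-cancelʳ-≤ ((q + U) * q * t + (q + U) * q * suc d) _ _ (begin
    U * (q * (suc d * suc d) + k * (q + U)) + ((q + U) * q * t + (q + U) * q * suc d)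
      ≤⟨ +-monoʳ-≤ (U * (q * (suc d * suc d) + k * (q + U))) (+-monoˡ-≤ ((q + U) * q * suc d) t-bound′) ⟩
    U * (q * (suc d * suc d) + k * (q + U)) + (d * (k * U * (q + U) + suc d * q * q) + (q + U) * q * suc d)
      ≡⟨ expand k q U d ⟩
    (q + U) * q * (suc d * suc d) + U * (q + k * (q + U)) * suc d
      ≡⟨ cong (λ z → (q + U) * q * z + U * (q + k * (q + U)) * suc d) square ⟩
    (q + U) * q * (t + P + suc d) + U * (q + k * (q + U)) * suc d
      ≡⟨ regroup ((q + U) * q) t P (suc d) (U * (q + k * (q + U))) ⟩
    (q + U) * q * P + U * (q + k * (q + U)) * suc d + ((q + U) * q * t + (q + U) * q * suc d) ∎)
    where
    open ≤-Reasoning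
    t-bound′ : (q + U) * q * t ≤ d * (k * U * (q + U) + suc d * q * q)
    t-bound′ = ≤-trans (≤-reflexive (reorder t (q + U) q)) t-bound
      where
      reorder : ∀ t p q → p * q * t ≡ t * p * q
      reorder = solve-∀
    expand : ∀ k q U d → U * (q * (suc d * suc d) + k * (q + U)) + (d * (k * U * (q + U) + suc d * q * q) + (q + U) * q * suc d)
                         ≡ (q + U) * q * (suc d * suc d) + U * (q + k * (q + U)) * suc d
    expand = solve-∀
    regroup : ∀ a t P d c → a * (t + P + d) + c * d ≡ a * P + c * d + (a * t + a * d)
    regroup = solve-∀

  -- The tangent line d² ≥ 2ad - a² at a = A/B makes the wedge bound linear in d.
  wedge-bound-tangent : ∀ k q U A B d t P → suc d * suc d ≡ t + P + suc d →
    t * (q + U) * q ≤ d * (k * U * (q + U) + suc d * q * q) →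
    2 * (U * q * A * B) * suc d + B * B * (U * k * (q + U))
      ≤ B * B * ((q + U) * q) * P + B * B * (U * (q + k * (q + U))) * suc d + U * q * (A * A)
  wedge-bound-tangent k q U A B d t P square t-bound = begin
    2 * (U * q * A * B) * suc d + B * B * (U * k * (q + U))
      ≡⟨ e₁ k q U A B (suc d) ⟩
    U * q * (2 * (A * (B * suc d))) + B * B * (U * k * (q + U))
      ≤⟨ +-monoˡ-≤ _ (*-monoʳ-≤ (U * q) (2*m*n≤m²+n² A (B * suc d))) ⟩
    U * q * (A * A + B * suc d * (B * suc d)) + B * B * (U * k * (q + U))
      ≡⟨ e₂ k q U A B (suc d) ⟩
    B * B * (U * (q * (suc d * suc d) + k * (q + U))) + U * q * (A * A)
      ≤⟨ +-monoˡ-≤ _ (*-monoʳ-≤ (B * B) (wedge-bound k q U d t P square t-bound)) ⟩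
    B * B * ((q + U) * q * P + U * (q + k * (q + U)) * suc d) + U * q * (A * A)
      ≡⟨ e₃ k q U A B (suc d) P ⟩
    B * B * ((q + U) * q) * P + B * B * (U * (q + k * (q + U))) * suc d + U * q * (A * A) ∎
    where
    open ≤-Reasoning
    e₁ : ∀ k q U A B d → 2 * (U * q * A * B) * d + B * B * (U * k * (q + U))
                         ≡ U * q * (2 * (A * (B * d))) + B * B * (U * k * (q + U))
    e₁ = solve-∀
    e₂ : ∀ k q U A B d → U * q * (A * A + B * d * (B * d)) + B * B * (U * k * (q + U))
                         ≡ B * B * (U * (q * (d * d) + k * (q + U))) + U * q * (A * A)
    e₂ = solve-∀
    e₃ : ∀ k q U A B d P → B * B * ((q + U) * q * P + U * (q + k * (q + U)) * d) + U * q * (A * A)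
                           ≡ B * B * ((q + U) * q) * P + B * B * (U * (q + k * (q + U))) * d + U * q * (A * A)
    e₃ = solve-∀

  eliminate-wedges : ∀ {a b c e f ℓ k X N NA PS P} → ℓ + b ≡ e + a * k → X + NA ≡ P → PS ≤ k * NA →
    e * X + N * f ≤ a * PS + b * X + N * c → X * ℓ + N * f ≤ a * k * P + N * c
  eliminate-wedges {a} {b} {c} {e} {f} {ℓ} {k} {X} {N} {NA} {PS} {P} ℓ+b≡ X+NA≡ PS≤ hyp =
    +-cancelʳ-≤ (b * X) _ _ (begin
      X * ℓ + N * f + b * X                     ≡⟨ e₁ X ℓ N f b ⟩
      (ℓ + b) * X + N * f                       ≡⟨ cong (λ z → z * X + N * f) ℓ+b≡ ⟩
      (e + a * k) * X + N * f                   ≡⟨ e₂ e a k X N f ⟩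
      e * X + N * f + a * k * X                 ≤⟨ +-monoˡ-≤ (a * k * X) hyp ⟩
      a * PS + b * X + N * c + a * k * X
        ≤⟨ +-monoˡ-≤ (a * k * X) (+-monoˡ-≤ (N * c) (+-monoˡ-≤ (b * X) (*-monoʳ-≤ a PS≤))) ⟩
      a * (k * NA) + b * X + N * c + a * k * X  ≡⟨ e₃ a k NA b X N c ⟩
      a * k * (X + NA) + N * c + b * X          ≡⟨ cong (λ z → a * k * z + N * c + b * X) X+NA≡ ⟩
      a * k * P + N * c + b * X                 ∎)
    where
    open ≤-Reasoning
    e₁ : ∀ X ℓ N f b → X * ℓ + N * f + b * X ≡ (ℓ + b) * X + N * f
    e₁ = solve-∀
    e₂ : ∀ e a k X N f → (e + a * k) * X + N * f ≡ e * X + N * f + a * k * X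
    e₂ = solve-∀
    e₃ : ∀ a k NA b X N c → a * (k * NA) + b * X + N * c + a * k * X ≡ a * k * (X + NA) + N * c + b * X
    e₃ = solve-∀

  -- One induction step, towards the bound for k + 1 = j + 2 at λ = p/q with p = q + U, on N vertices
  -- where N q = ν = (k + 1)p + W, i.e. W/q = N - (k + 1)λ ≥ 0; also μ = (N - 1)q. The target is
  -- 2e ≤ (N - 1)C/B with B = pq and C/B = (k + 1)(λ - 1) + N/λ, and the tangent point is A/B = C/B - 1.
  -- Summed over all vertices, the tangent inequalities give 2e·B·L ≤ N q R.
  module Tangent (j q′ U W : ℕ) where
    q k p A B C L R ν μ : ℕ
    q = suc q′
    k = suc j
    p = q + U
    A = k * p * p + p * U + q * W
    B = p * q
    C = suc k * p * p + q * W
    L = p * q * q * (k * q + j * U) + U * q * k * p * p + 2 * p * q * U * U + 2 * q * q * U * W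
    R = p * p * p * q * k * (k * p + W) + U * (A * A)
    ν = suc k * p + W
    μ = k * p + U + W

    -- μCL - qνR = Uq·Pos + T((k + 1)U + W - q), where (k + 1)U + W - q = (N - k - 2)q ≥ 0.
    certificate : q ≤ suc k * U + W → q * (ν * R) ≤ μ * C * L
    certificate q≤ = +-cancelʳ-≤ (T * q) _ _ (begin
      q * (ν * R) + T * q                              ≤⟨ +-monoʳ-≤ (q * (ν * R)) (*-monoʳ-≤ T q≤) ⟩
      q * (ν * R) + T * (suc k * U + W)                ≤⟨ +-monoˡ-≤ (T * (suc k * U + W)) (m≤m+n (q * (ν * R)) (U * q * Pos)) ⟩
      q * (ν * R) + U * q * Pos + T * (suc k * U + W)  ≡⟨ identity j q U W ⟨
      μ * C * L + T * q                                ∎)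
      where
      open ≤-Reasoning
      T Pos : ℕ
      T = U * W * p * p * q * q
      Pos = suc k * U * p * p * p * (j * p + 2 * U)
          + W * U * p * (j * p * (U + 3 * q) + 2 * U * U + 7 * U * q + 2 * q * q)
          + W * W * q * (j * p * q + 3 * U * q + U * U) + W * W * W * q * q
      identity : ∀ j q U W →
        let k = suc j ; p = q + U ; A = k * p * p + p * U + q * W in
        (k * p + U + W) * (suc k * p * p + q * W)
          * (p * q * q * (k * q + j * U) + U * q * k * p * p + 2 * p * q * U * U + 2 * q * q * U * W)
          + U * W * p * p * q * q * q
        ≡ q * ((suc k * p + W) * (p * p * p * q * k * (k * p + W) + U * (A * A)))
          + U * q * (suc k * U * p * p * p * (j * p + 2 * U)
                     + W * U * p * (j * p * (U + 3 * q) + 2 * U * U + 7 * U * q + 2 * q * q)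
                     + W * W * q * (j * p * q + 3 * U * q + U * U) + W * W * W * q * q)
          + U * W * p * p * q * q * (suc k * U + W)
      identity = solve-∀

    L-positive : NonZero (q * L)
    L-positive = _

    L-identity : B * L + B * B * (U * (q + k * p)) ≡ 2 * (U * q * A * B) + B * B * (p * q) * k
    L-identity = identity j q U W
      where
      identity : ∀ j q U W → let k = suc j ; p = q + U ; B = p * q ; A = k * p * p + p * U + q * W in
        B * (p * q * q * (k * q + j * U) + U * q * k * p * p + 2 * p * q * U * U + 2 * q * q * U * W)
          + B * B * (U * (q + k * p))
        ≡ 2 * (U * q * A * B) + B * B * (p * q) * k
      identity = solve-∀

    Mq≡μ : ∀ M → suc M * q ≡ ν → M * q ≡ μ
    Mq≡μ M Nq≡ν = +-cancelˡ-≡ q _ _ (trans Nq≡ν (ν≡q+μ j q U W))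
      where
      ν≡q+μ : ∀ j q U W → suc (suc j) * (q + U) + W ≡ q + (suc j * (q + U) + U + W)
      ν≡q+μ = solve-∀

    summed-bound : ∀ M X NA PS → suc M * q ≡ ν → X + NA ≡ suc M * M → PS ≤ k * NA →
      2 * (U * q * A * B) * X + suc M * (B * B * (U * k * p))
        ≤ B * B * (p * q) * PS + B * B * (U * (q + k * p)) * X + suc M * (U * q * (A * A)) →
      X * (B * L) ≤ suc M * q * R
    summed-bound M X NA PS Nq≡ν pairs PS≤ tangent = +-cancelʳ-≤ (suc M * (B * B * (U * k * p))) _ _ (begin
      X * (B * L) + suc M * (B * B * (U * k * p))
        ≤⟨ eliminate-wedges {B * B * (p * q)} {B * B * (U * (q + k * p))} {U * q * (A * A)} {2 * (U * q * A * B)}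
                            {B * B * (U * k * p)} {B * L} {k} {X} {suc M} L-identity pairs PS≤ tangent ⟩
      B * B * (p * q) * k * (suc M * M) + suc M * (U * q * (A * A))         ≡⟨ cong (_+ c) (e₁ p q k (suc M) M) ⟩
      p * p * p * q * q * k * suc M * (M * q) + suc M * (U * q * (A * A))   ≡⟨ cong (λ z → a * z + c) (Mq≡μ M Nq≡ν) ⟩
      p * p * p * q * q * k * suc M * μ + suc M * (U * q * (A * A))         ≡⟨ e₂ j q U W (suc M) ⟩
      suc M * q * R + suc M * (B * B * (U * k * p))                         ∎)
      where
      open ≤-Reasoning
      a = p * p * p * q * q * k * suc M
      c = suc M * (U * q * (A * A))
      e₁ : ∀ p q k N M → p * q * (p * q) * (p * q) * k * (N * M) ≡ p * p * p * q * q * k * N * (M * q)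
      e₁ = solve-∀
      e₂ : ∀ j q U W N → let k = suc j ; p = q + U ; A = k * p * p + p * U + q * W in
        p * p * p * q * q * k * N * (k * p + U + W) + N * (U * q * (A * A))
        ≡ N * q * (p * p * p * q * k * (k * p + W) + U * (A * A)) + N * (p * q * (p * q) * (U * k * p))
      e₂ = solve-∀

    bound : ∀ M X NA PS → suc M * q ≡ ν → q ≤ suc k * U + W →
      X + NA ≡ suc M * M → PS ≤ k * NA →
      2 * (U * q * A * B) * X + suc M * (B * B * (U * k * p))
        ≤ B * B * (p * q) * PS + B * B * (U * (q + k * p)) * X + suc M * (U * q * (A * A)) →
      X * p * q ≤ M * (suc k * U * p + suc M * q * q)
    bound M X NA PS Nq≡ν q≤ pairs PS≤ tangent = *-cancelʳ-≤ _ _ (q * L) {{L-positive}} (begin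
      X * p * q * (q * L)                           ≡⟨ e₁ X p q L ⟩
      q * (X * (B * L))                             ≤⟨ *-monoʳ-≤ q (summed-bound M X NA PS Nq≡ν pairs PS≤ tangent) ⟩
      q * (suc M * q * R)                           ≡⟨ cong (λ z → q * (z * R)) Nq≡ν ⟩
      q * (ν * R)                                   ≤⟨ certificate q≤ ⟩
      μ * C * L                                     ≡⟨ cong (λ z → z * C * L) (Mq≡μ M Nq≡ν) ⟨
      M * q * C * L                                 ≡⟨ cong (λ z → M * q * z * L) C≡ ⟨
      M * q * (suc k * U * p + suc M * q * q) * L   ≡⟨ e₂ M q (suc k * U * p + suc M * q * q) L ⟩
      M * (suc k * U * p + suc M * q * q) * (q * L) ∎)
      where
      open ≤-Reasoning
      e₁ : ∀ X p q L → X * p * q * (q * L) ≡ q * (X * (p * q * L))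
      e₁ = solve-∀
      e₂ : ∀ M q C L → M * q * C * L ≡ M * C * (q * L)
      e₂ = solve-∀
      C≡ : suc k * U * p + suc M * q * q ≡ C
      C≡ = trans (cong (λ z → suc k * U * p + z * q) Nq≡ν) (e j q U W)
        where
        e : ∀ j q U W → suc (suc j) * U * (q + U) + (suc (suc j) * (q + U) + W) * q
                        ≡ suc (suc j) * (q + U) * (q + U) + q * W
        e = solve-∀

  -- For N q ≤ (k + 1)(q + U) the bound already follows from X ≤ N(N - 1).
  edge-bound : ∀ k q U N X NA PS → 1 ≤ k → N * N ≡ X + NA + N → PS ≤ k * NA →
    (∀ A B → 2 * (U * q * A * B) * X + N * (B * B * (U * k * (q + U)))
               ≤ B * B * ((q + U) * q) * PS + B * B * (U * (q + k * (q + U))) * X + N * (U * q * (A * A))) →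
    X * (q + U) * q ≤ (N ∸ 1) * (suc k * U * (q + U) + N * q * q)
  edge-bound k q U zero X NA PS _ counting _ _ rewrite m+n≡0⇒m≡0 X (distinct-pairs 0 X NA counting) = z≤n
  edge-bound k q U (suc M) X NA PS 1≤k counting PS≤ tangent with suc M * q ≤? suc k * (q + U)
  ... | yes Nq≤ = begin
    X * (q + U) * q                            ≤⟨ *-monoˡ-≤ q (*-monoˡ-≤ (q + U) X≤) ⟩
    suc M * M * (q + U) * q                    ≡⟨ e M q U ⟩
    M * (suc M * q * U + suc M * q * q)        ≤⟨ *-monoʳ-≤ M (+-monoˡ-≤ (suc M * q * q) (*-monoˡ-≤ U Nq≤)) ⟩
    M * (suc k * (q + U) * U + suc M * q * q)  ≡⟨ cong (λ z → M * (z + suc M * q * q)) (e′ k q U) ⟩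
    M * (suc k * U * (q + U) + suc M * q * q)  ∎
    where
    open ≤-Reasoning
    X≤ : X ≤ suc M * M
    X≤ = ≤-trans (m≤m+n X NA) (≤-reflexive (distinct-pairs (suc M) X NA counting))
    e : ∀ M q U → suc M * M * (q + U) * q ≡ M * (suc M * q * U + suc M * q * q)
    e = solve-∀
    e′ : ∀ k q U → suc k * (q + U) * U ≡ suc k * U * (q + U)
    e′ = solve-∀
  edge-bound (suc j) (suc q′) U (suc M) X NA PS _ counting PS≤ tangent | no Nq≰ =
    Tangent.bound j q′ U W M X NA PS Nq≡ν q≤ (distinct-pairs (suc M) X NA counting) PS≤ (tangent _ _)
    where
    q = suc q′
    k = suc j
    W = suc M * q ∸ suc k * (q + U)
    Nq≡ν : suc M * q ≡ suc k * (q + U) + W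
    Nq≡ν = sym (m+[n∸m]≡n (<⇒≤ (≰⇒> Nq≰)))
    k+2≤N : suc (suc k) ≤ suc M
    k+2≤N = *-cancelʳ-< q (suc k) (suc M) (≤-<-trans (*-monoʳ-≤ (suc k) (m≤m+n q U)) (≰⇒> Nq≰))
    q≤ : q ≤ suc k * U + W
    q≤ = +-cancelˡ-≤ (suc k * q) _ _ (begin
      suc k * q + q                  ≡⟨ +-comm (suc k * q) q ⟩
      suc (suc k) * q                ≤⟨ *-monoˡ-≤ q k+2≤N ⟩
      suc M * q                      ≡⟨ Nq≡ν ⟩
      suc k * (q + U) + W            ≡⟨ e (suc k) q U W ⟩
      suc k * q + (suc k * U + W)    ∎)
      where
      open ≤-Reasoning
      e : ∀ k q U W → k * (q + U) + W ≡ k * q + (k * U + W)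
      e = solve-∀
  edge-bound (suc j) zero U (suc M) X NA PS _ _ _ _ | no Nq≰ =
    ⊥-elim (Nq≰ (subst (_≤ suc (suc j) * U) (sym (*-zeroʳ (suc M))) z≤n))

  -- Minimise over λ: take λ = (X + km)/(2km) when this is at least 1.
  edge-bound-optimised : ∀ k m X → 1 ≤ k → k ≤ suc m →
    (∀ q U → X * (q + U) * q ≤ m * (k * U * (q + U) + suc m * q * q)) →
    (X + k * m) * (X + k * m) ≤ 4 * k * suc m * (m * m)
  edge-bound-optimised k zero X _ _ bound rewrite *-zeroʳ k
    with trans (sym (trans (*-identityʳ (X * 1)) (*-identityʳ X))) (n≤0⇒n≡0 (bound 1 0))
  ... | refl = z≤n
  edge-bound-optimised k@(suc _) m@(suc _) X _ k≤n bound with X + k * m ≤? 2 * k * m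
  ... | yes small = begin
    (X + k * m) * (X + k * m)  ≤⟨ *-mono-≤ small small ⟩
    2 * k * m * (2 * k * m)    ≡⟨ e k m ⟩
    4 * k * k * (m * m)        ≤⟨ *-monoˡ-≤ (m * m) (*-monoʳ-≤ (4 * k) k≤n) ⟩
    4 * k * suc m * (m * m)    ∎
    where
    open ≤-Reasoning
    e : ∀ k m → 2 * k * m * (2 * k * m) ≡ 4 * k * k * (m * m)
    e = solve-∀
  ... | no large = subst (λ p → p * p ≤ 4 * k * suc m * (m * m)) (sym X+km≡p)
    (+-cancelˡ-≤ (U * p) _ _ (*-cancelˡ-≤ (k * m) (begin
      k * m * (U * p + p * p)                ≡⟨ e₁ k m U ⟨
      (k * m + U) * p * q                    ≡⟨ cong (λ x → x * p * q) X≡km+U ⟨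
      X * p * q                              ≤⟨ bound q U ⟩
      m * (k * U * p + suc m * q * q)        ≡⟨ e₂ k m U ⟩
      k * m * (U * p + 4 * k * suc m * (m * m)) ∎)))
    where
    open ≤-Reasoning
    q = 2 * k * m
    U = X + k * m ∸ q
    p = q + U
    X+km≡p : X + k * m ≡ p
    X+km≡p = sym (m+[n∸m]≡n (<⇒≤ (≰⇒> large)))
    X≡km+U : X ≡ k * m + U
    X≡km+U = +-cancelʳ-≡ (k * m) _ _ (trans X+km≡p (e₃ k m U))
      where
      e₃ : ∀ k m U → 2 * k * m + U ≡ k * m + U + k * m
      e₃ = solve-∀
    e₁ : ∀ k m U → (k * m + U) * (2 * k * m + U) * (2 * k * m)
                   ≡ k * m * (U * (2 * k * m + U) + (2 * k * m + U) * (2 * k * m + U))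
    e₁ = solve-∀
    e₂ : ∀ k m U → m * (k * U * (2 * k * m + U) + suc m * (2 * k * m) * (2 * k * m))
                   ≡ k * m * (U * (2 * k * m + U) + 4 * k * suc m * (m * m))
    e₂ = solve-∀

module Graphs {n} (G : Graph n) where

  open import Data.Bool using (Bool; true; false; _∧_; not)
  open import Data.Bool.Properties using (∧-zeroʳ; ∧-identityʳ; ∧-conicalˡ; ∧-conicalʳ) renaming (_≟_ to _≟ᵇ_)
  open import Data.Nat hiding (_≟_)
  open import Data.Nat.Properties hiding (_≟_)
  open import Data.Nat.Tactic.RingSolver using (solve-∀)
  open import Data.Fin using (Fin; toℕ)
  open import Data.Fin.Properties using (_≟_; toℕ-injective)
  open import Data.List using (List; []; _∷_; length; filter; allFin)
  open import Data.List.Relation.Unary.All as All using (All; []; _∷_)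
  open import Data.List.Relation.Unary.All.Properties using (all-filter)
  open import Data.List.Relation.Unary.AllPairs using (AllPairs; []; _∷_)
  open import Data.List.Relation.Unary.Unique.Propositional using (Unique)
  import Data.List.Relation.Unary.Unique.Propositional.Properties as Unique
  open import Data.Product using (Σ-syntax; _×_; _,_; proj₁; proj₂)
  open import Data.Empty using (⊥-elim)
  open import Function using (_∘_; case_of_)
  open import Relation.Nullary using (¬_; does; yes; no)
  open import Relation.Nullary.Decidable using (dec-true; dec-false; _×-dec_)
  open import Relation.Binary using (tri<; tri≈; tri>)
  open import Relation.Binary.PropositionalEquality
  open Finite
  open Arithmetic using (wedge-bound-tangent; edge-bound)

  adjacent⇒distinct : ∀ {u v} → Adj G u v → u ≢ v
  adjacent⇒distinct {u} uv refl with () ← trans (sym uv) (adj-irrefl G u)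

  deg : (Fin n → Bool) → Fin n → ℕ
  deg S w = ∑[ v ∈ S ] 𝟙 (adj G w v)

  degSum : (Fin n → Bool) → ℕ
  degSum S = ∑[ w ∈ S ] deg S w

  nonadj : Fin n → Fin n → Bool
  nonadj x y = not (adj G x y) ∧ not (does (x ≟ y))

  nonEdges : (Fin n → Bool) → ℕ
  nonEdges S = ∑[ x ∈ S ] ∑[ y ∈ S ] 𝟙 (nonadj x y)

  codeg : (Fin n → Bool) → Fin n → Fin n → ℕ
  codeg S x y = ∑[ w ∈ S ] (𝟙 (adj G w x) * 𝟙 (adj G w y))

  nbhd : (Fin n → Bool) → Fin n → (Fin n → Bool)
  nbhd S w = S ∩ adj G w

  adjacent-nonadjacent-equal : ∀ x y → 𝟙 (adj G x y) + 𝟙 (nonadj x y) + 𝟙 (does (x ≟ y)) ≡ 1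
  adjacent-nonadjacent-equal x y with adj G x y in xy | x ≟ y
  ... | true  | yes refl = ⊥-elim (adjacent⇒distinct xy refl)
  ... | true  | no _ = refl
  ... | false | yes _ = refl
  ... | false | no _ = refl

  ordered-pairs : ∀ S → size S * size S ≡ degSum S + nonEdges S + size S
  ordered-pairs S = begin
    size S * size S                        ≡⟨ ∑∈-const S (size S) ⟨
    ∑[ x ∈ S ] ∑[ y ∈ S ] 1
      ≡⟨ ∑∈-cong S (λ x _ → ∑∈-cong S (λ y _ → sym (adjacent-nonadjacent-equal x y))) ⟩
    ∑[ x ∈ S ] ∑[ y ∈ S ] (𝟙 (adj G x y) + 𝟙 (nonadj x y) + 𝟙 (does (x ≟ y)))
      ≡⟨ ∑∈-cong S (λ x _ → trans (∑∈-distrib-+ S _ _) (cong (_+ _) (∑∈-distrib-+ S _ _))) ⟩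
    ∑[ x ∈ S ] (deg S x + ∑[ y ∈ S ] 𝟙 (nonadj x y) + ∑[ y ∈ S ] 𝟙 (does (x ≟ y)))
      ≡⟨ trans (∑∈-distrib-+ S _ _) (cong (_+ _) (∑∈-distrib-+ S _ _)) ⟩
    degSum S + nonEdges S + ∑[ x ∈ S ] ∑[ y ∈ S ] 𝟙 (does (x ≟ y))
      ≡⟨ cong (degSum S + nonEdges S +_) (∑∈-cong S diagonal) ⟩
    degSum S + nonEdges S + size S ∎
    where
    open ≡-Reasoning
    diagonal : ∀ x → S x ≡ true → ∑[ y ∈ S ] 𝟙 (does (x ≟ y)) ≡ 1
    diagonal x Sx = trans (sum-cong-≗ (λ y → *-comm (𝟙 (S y)) _)) (trans (∑-sift x (λ y → 𝟙 (S y))) (cong 𝟙 Sx))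

  size-nbhd : ∀ S w → size (nbhd S w) ≡ deg S w
  size-nbhd S w = trans (∑∈-∩ S (adj G w) (λ _ → 1)) (∑∈-cong S (λ v _ → *-identityʳ _))

  ∑-nonEdges-nbhd : ∀ S → ∑[ w ∈ S ] nonEdges (nbhd S w) ≡ ∑[ x ∈ S ] ∑[ y ∈ S ] (𝟙 (nonadj x y) * codeg S x y)
  ∑-nonEdges-nbhd S = begin
    ∑[ w ∈ S ] nonEdges (nbhd S w)                   ≡⟨ ∑∈-cong S (λ w _ → expand w) ⟩
    ∑[ w ∈ S ] ∑[ x ∈ S ] ∑[ y ∈ S ] F w x y         ≡⟨ ∑∈-comm S S (λ w x → ∑[ y ∈ S ] F w x y) ⟩
    ∑[ x ∈ S ] ∑[ w ∈ S ] ∑[ y ∈ S ] F w x y         ≡⟨ ∑∈-cong S (λ x _ → ∑∈-comm S S (λ w y → F w x y)) ⟩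
    ∑[ x ∈ S ] ∑[ y ∈ S ] ∑[ w ∈ S ] F w x y         ≡⟨ ∑∈-cong S (λ x _ → ∑∈-cong S (λ y _ → collect x y)) ⟩
    ∑[ x ∈ S ] ∑[ y ∈ S ] (𝟙 (nonadj x y) * codeg S x y) ∎
    where
    open ≡-Reasoning
    F : Fin n → Fin n → Fin n → ℕ
    F w x y = 𝟙 (adj G w x) * (𝟙 (adj G w y) * 𝟙 (nonadj x y))
    expand : ∀ w → nonEdges (nbhd S w) ≡ ∑[ x ∈ S ] ∑[ y ∈ S ] F w x y
    expand w = trans (∑∈-∩ S (adj G w) _) (∑∈-cong S (λ x _ →
                 trans (cong (𝟙 (adj G w x) *_) (∑∈-∩ S (adj G w) _)) (sym (∑∈-*ˡ S (𝟙 (adj G w x)) _))))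
    collect : ∀ x y → ∑[ w ∈ S ] F w x y ≡ 𝟙 (nonadj x y) * codeg S x y
    collect x y = trans (∑∈-cong S (λ w _ → rearrange (𝟙 (adj G w x)) (𝟙 (adj G w y)) (𝟙 (nonadj x y))))
                        (∑∈-*ˡ S (𝟙 (nonadj x y)) _)
      where
      rearrange : ∀ a b c → a * (b * c) ≡ c * (a * b)
      rearrange = solve-∀

  ∑-nonEdges-nbhd-≤ : ∀ S k → (∀ x y → S x ≡ true → S y ≡ true → nonadj x y ≡ true → codeg S x y ≤ k) →
    ∑[ w ∈ S ] nonEdges (nbhd S w) ≤ k * nonEdges S
  ∑-nonEdges-nbhd-≤ S k codeg≤ = begin
    ∑[ w ∈ S ] nonEdges (nbhd S w)                          ≡⟨ ∑-nonEdges-nbhd S ⟩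
    ∑[ x ∈ S ] ∑[ y ∈ S ] (𝟙 (nonadj x y) * codeg S x y)
      ≤⟨ ∑∈-mono-≤ S (λ x Sx → ∑∈-mono-≤ S (λ y Sy → pair x y Sx Sy)) ⟩
    ∑[ x ∈ S ] ∑[ y ∈ S ] (k * 𝟙 (nonadj x y))             ≡⟨ trans (∑∈-cong S (λ x _ → ∑∈-*ˡ S k _)) (∑∈-*ˡ S k _) ⟩
    k * nonEdges S                                          ∎
    where
    open ≤-Reasoning
    pair : ∀ x y → S x ≡ true → S y ≡ true → 𝟙 (nonadj x y) * codeg S x y ≤ k * 𝟙 (nonadj x y)
    pair x y Sx Sy with nonadj x y in xy
    ... | false = z≤n
    ... | true = subst₂ _≤_ (sym (+-identityʳ _)) (sym (*-identityʳ k)) (codeg≤ x y Sx Sy xy)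

  -- The wedge bound needs positive degrees, so the induction step runs on the non-isolated
  -- vertices, which carry all the edges.
  nonIsolated : (Fin n → Bool) → (Fin n → Bool)
  nonIsolated S = S ∩ (λ v → does (1 ≤? deg S v))

  nonIsolated-⊆ : ∀ S v → nonIsolated S v ≡ true → S v ≡ true
  nonIsolated-⊆ S v Sv⁺ with S v
  ... | true = refl

  deg-nonIsolated : ∀ S w → S w ≡ true → deg (nonIsolated S) w ≡ deg S w
  deg-nonIsolated S w Sw = trans (∑∈-∩ S _ _) (∑∈-cong S pointwise)
    where
    pointwise : ∀ v → S v ≡ true → 𝟙 (does (1 ≤? deg S v)) * 𝟙 (adj G w v) ≡ 𝟙 (adj G w v)
    pointwise v Sv with adj G w v in wv
    ... | false = *-zeroʳ (𝟙 (does (1 ≤? deg S v)))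
    ... | true = cong (_* 1) (cong 𝟙 (dec-true (1 ≤? deg S v) w∈N[v]))
      where
      w∈N[v] : 1 ≤ deg S v
      w∈N[v] = subst (_≤ deg S v) (cong₂ (λ a b → 𝟙 a * 𝟙 b) Sw (trans (adj-sym G v w) wv))
                     (term≤∑ (λ u → 𝟙 (S u) * 𝟙 (adj G v u)) w)

  degSum-nonIsolated : ∀ S → degSum (nonIsolated S) ≡ degSum S
  degSum-nonIsolated S = trans (∑∈-∩ S _ _) (∑∈-cong S (λ w Sw →
    trans (cong (𝟙 (does (1 ≤? deg S w)) *_) (deg-nonIsolated S w Sw)) (drop-zero (deg S w))))
    where
    drop-zero : ∀ d → 𝟙 (does (1 ≤? d)) * d ≡ d
    drop-zero zero = refl
    drop-zero (suc d) = +-identityʳ (suc d)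

  size-nonIsolated-≤ : ∀ S → size (nonIsolated S) ≤ size S
  size-nonIsolated-≤ S = ≤-trans (≤-reflexive (∑∈-∩ S _ _)) (∑∈-mono-≤ S (λ v _ → 𝟙≤1 (does (1 ≤? deg S v))))
    where
    𝟙≤1 : ∀ b → 𝟙 b * 1 ≤ 1
    𝟙≤1 true = ≤-refl
    𝟙≤1 false = z≤n

  nonIsolated-deg≥1 : ∀ S w → nonIsolated S w ≡ true → 1 ≤ deg (nonIsolated S) w
  nonIsolated-deg≥1 S w Sw⁺ =
    subst (1 ≤_) (sym (deg-nonIsolated S w (nonIsolated-⊆ S w Sw⁺))) (has-neighbour (S w) (deg S w) Sw⁺)
    where
    has-neighbour : ∀ b d → b ∧ does (1 ≤? d) ≡ true → 1 ≤ d
    has-neighbour true (suc d) _ = s≤s z≤n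
    has-neighbour false (suc d) _ = s≤s z≤n

  -- For λ = (q + U)/q this is 2e(S) ≤ (|S| - 1)(k(λ - 1) + |S|/λ), as degSum S = 2e(S).
  EdgeBound : ℕ → (Fin n → Bool) → Set
  EdgeBound k S = ∀ q U → degSum S * (q + U) * q ≤ (size S ∸ 1) * (k * U * (q + U) + size S * q * q)

  EdgeBound-nonIsolated : ∀ k S → EdgeBound k (nonIsolated S) → EdgeBound k S
  EdgeBound-nonIsolated k S bound q U = begin
    degSum S * (q + U) * q                  ≡⟨ cong (λ e → e * (q + U) * q) (degSum-nonIsolated S) ⟨
    degSum (nonIsolated S) * (q + U) * q    ≤⟨ bound q U ⟩
    (size (nonIsolated S) ∸ 1) * (k * U * (q + U) + size (nonIsolated S) * q * q)
      ≤⟨ *-mono-≤ (∸-monoˡ-≤ 1 N⁺≤N) (+-monoʳ-≤ (k * U * (q + U)) (*-monoˡ-≤ q (*-monoˡ-≤ q N⁺≤N))) ⟩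
    (size S ∸ 1) * (k * U * (q + U) + size S * q * q)              ∎
    where
    open ≤-Reasoning
    N⁺≤N = size-nonIsolated-≤ S

  wedge-bound-at : ∀ k q U A B S w → 1 ≤ deg S w → EdgeBound k (nbhd S w) →
    2 * (U * q * A * B) * deg S w + B * B * (U * k * (q + U))
      ≤ B * B * ((q + U) * q) * nonEdges (nbhd S w) + B * B * (U * (q + k * (q + U))) * deg S w + U * q * (A * A)
  wedge-bound-at k q U A B S w deg≥1 bound with deg S w in d≡ | deg≥1
  ... | suc d | _ = wedge-bound-tangent k q U A B d (degSum N[w]) (nonEdges N[w]) square bound′
    where
    N[w] = nbhd S w
    size≡ : size N[w] ≡ suc d
    size≡ = trans (size-nbhd S w) d≡
    square : suc d * suc d ≡ degSum N[w] + nonEdges N[w] + suc d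
    square = subst (λ m → m * m ≡ degSum N[w] + nonEdges N[w] + m) size≡ (ordered-pairs N[w])
    bound′ : degSum N[w] * (q + U) * q ≤ d * (k * U * (q + U) + suc d * q * q)
    bound′ = subst (λ m → degSum N[w] * (q + U) * q ≤ (m ∸ 1) * (k * U * (q + U) + m * q * q)) size≡ (bound q U)

  EdgeBound-step : ∀ k S → 1 ≤ k → (∀ w → S w ≡ true → 1 ≤ deg S w) →
    (∀ w → S w ≡ true → EdgeBound k (nbhd S w)) →
    (∀ x y → S x ≡ true → S y ≡ true → nonadj x y ≡ true → codeg S x y ≤ k) →
    EdgeBound (suc k) S
  EdgeBound-step k S 1≤k deg≥1 nbhd-bound codeg≤ q U =
    edge-bound k q U (size S) (degSum S) (nonEdges S) (∑[ w ∈ S ] nonEdges (nbhd S w))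
               1≤k (ordered-pairs S) (∑-nonEdges-nbhd-≤ S k codeg≤)
               (λ A B → ∑∈-affine-≤ S {B * B * ((q + U) * q)} {B * B * (U * (q + k * (q + U)))} {U * q * (A * A)}
                                      {2 * (U * q * A * B)} {B * B * (U * k * (q + U))}
                                      (deg S) (λ w → nonEdges (nbhd S w))
                                      (λ w Sw → wedge-bound-at k q U A B S w (deg≥1 w Sw) (nbhd-bound w Sw)))

  CliqueIn : (Fin n → Bool) → ℕ → Set
  CliqueIn S k = Σ[ C ∈ List (Fin n) ] IsClique G C × All (λ v → S v ≡ true) C × k ≤ length C

  members : (Fin n → Bool) → List (Fin n)
  members S = filter (λ v → S v ≟ᵇ true) (allFin n)

  length-members : ∀ S → length (members S) ≡ size S
  length-members S = trans (length-filter-tabulate (λ v → S v ≟ᵇ true) (λ v → v)) (sum-cong-≗ pointwise)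
    where
    pointwise : ∀ v → 𝟙 (does (S v ≟ᵇ true)) ≡ 𝟙 (S v) * 1
    pointwise v with S v
    ... | true = refl
    ... | false = refl

  clique-⊆ : ∀ {S T k} → (∀ v → T v ≡ true → S v ≡ true) → CliqueIn T k → CliqueIn S k
  clique-⊆ T⊆S (C , clique , C⊆T , k≤) = C , clique , All.map (T⊆S _) C⊆T , k≤

  clique-cons : ∀ {S w k} → S w ≡ true → CliqueIn (nbhd S w) k → CliqueIn S (suc k)
  clique-cons {S} {w} Sw (C , (unique , pairs) , C⊆N[w] , k≤) =
    w ∷ C , (All.map adjacent⇒distinct w~C ∷ unique , w~C ∷ pairs) ,
    Sw ∷ All.map (λ {v} → ∧-conicalˡ (S v) (adj G w v)) C⊆N[w] , s≤s k≤
    where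
    w~C : All (Adj G w) C
    w~C = All.map (λ {v} → ∧-conicalʳ (S v) (adj G w v)) C⊆N[w]

  edge-clique : ∀ {S x y} → S x ≡ true → S y ≡ true → Adj G x y → CliqueIn S 2
  edge-clique Sx Sy xy =
    _ ∷ _ ∷ [] , ((adjacent⇒distinct xy ∷ []) ∷ [] ∷ [] , (xy ∷ []) ∷ [] ∷ []) , Sx ∷ Sy ∷ [] , ≤-refl

  pairwise-adjacent : ∀ {P : Fin n → Set} {xs} → Unique xs → All P xs →
    (∀ {u v} → P u → P v → u ≢ v → Adj G u v) → AllPairs (Adj G) xs
  pairwise-adjacent [] [] _ = []
  pairwise-adjacent (u∉ ∷ unique) (Pu ∷ Pxs) adjacent =
    All.zipWith (λ (Pv , u≢v) → adjacent Pu Pv u≢v) (Pxs , u∉) ∷ pairwise-adjacent unique Pxs adjacent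

  nonadj⇒¬adj×≢ : ∀ {x y} → nonadj x y ≡ true → ¬ Adj G x y × x ≢ y
  nonadj⇒¬adj×≢ {x} {y} x≁y with adj G x y | x ≟ y
  ... | false | no x≢y = (λ ()) , x≢y

  common-nbhd-clique : ¬ HasInducedC4 G → ∀ {S x y k} → S x ≡ true → S y ≡ true → nonadj x y ≡ true →
    k < codeg S x y → CliqueIn S (suc (suc k))
  common-nbhd-clique noC4 {S} {x} {y} {k} Sx Sy x≁y k<codeg =
    x ∷ M , (All.map (adjacent⇒distinct ∘ x~) M-common ∷ M-unique , All.map x~ M-common ∷ M-clique) ,
    Sx ∷ All.map (λ {w} → ∧-conicalˡ (S w) _) M-common , s≤s (subst (suc k ≤_) (sym |M|≡codeg) k<codeg)
    where
    common : Fin n → Bool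
    common = S ∩ (λ w → adj G w x ∧ adj G w y)
    M = members common
    M-common : All (λ w → common w ≡ true) M
    M-common = all-filter (λ v → common v ≟ᵇ true) (allFin n)
    M-unique : Unique M
    M-unique = Unique.filter⁺ (λ v → common v ≟ᵇ true) (Unique.allFin⁺ n)
    ~x : ∀ {w} → common w ≡ true → Adj G w x
    ~x {w} cw = ∧-conicalˡ (adj G w x) (adj G w y) (∧-conicalʳ (S w) _ cw)
    ~y : ∀ {w} → common w ≡ true → Adj G w y
    ~y {w} cw = ∧-conicalʳ (adj G w x) (adj G w y) (∧-conicalʳ (S w) _ cw)
    x~ : ∀ {w} → common w ≡ true → Adj G x w
    x~ {w} cw = trans (adj-sym G x w) (~x cw)
    M-clique : AllPairs (Adj G) M
    M-clique = pairwise-adjacent M-unique M-common adjacent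
      where
      adjacent : ∀ {u v} → common u ≡ true → common v ≡ true → u ≢ v → Adj G u v
      adjacent {u} {v} cu cv u≢v with adj G u v in uv
      ... | true = refl
      ... | false = ⊥-elim (noC4 (x , u , y , v , proj₂ (nonadj⇒¬adj×≢ x≁y) , u≢v ,
                                  x~ cu , ~y cu , trans (adj-sym G y v) (~y cv) , ~x cv ,
                                  proj₁ (nonadj⇒¬adj×≢ x≁y) , λ u~v → case (trans (sym u~v) uv) of λ ()))
    |M|≡codeg : length M ≡ codeg S x y
    |M|≡codeg = trans (length-members common) (trans (∑∈-∩ S _ _) (∑∈-cong S (λ w _ →
                  trans (*-identityʳ _) (𝟙-∧ (adj G w x) (adj G w y)))))

  increasing-edge : Fin n → Fin n → ℕ
  increasing-edge x y = 𝟙 (does (toℕ x <? toℕ y) ∧ does (adj G x y ≟ᵇ true))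

  increasing-edges : ∀ x y → increasing-edge x y + increasing-edge y x ≡ 𝟙 (adj G x y)
  increasing-edges x y rewrite does-≟-true (adj G x y) | does-≟-true (adj G y x) | adj-sym G y x with adj G x y in xy
  ... | false rewrite ∧-zeroʳ (does (toℕ x <? toℕ y)) | ∧-zeroʳ (does (toℕ y <? toℕ x)) = refl
  ... | true rewrite ∧-identityʳ (does (toℕ x <? toℕ y)) | ∧-identityʳ (does (toℕ y <? toℕ x)) with <-cmp (toℕ x) (toℕ y)
  ...   | tri< x<y _ _ rewrite dec-true (toℕ x <? toℕ y) x<y | dec-false (toℕ y <? toℕ x) (<-asym x<y) = refl
  ...   | tri> _ _ y<x rewrite dec-false (toℕ x <? toℕ y) (<-asym y<x) | dec-true (toℕ y <? toℕ x) y<x = refl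
  ...   | tri≈ _ x≡y _ = ⊥-elim (adjacent⇒distinct xy (toℕ-injective x≡y))

  2*edgeCount≡degSum : 2 * edgeCount G ≡ degSum full
  2*edgeCount≡degSum = begin
    2 * edgeCount G                                      ≡⟨ cong (edgeCount G +_) (+-identityʳ (edgeCount G)) ⟩
    edgeCount G + edgeCount G                            ≡⟨ cong₂ _+_ count (trans count (∑-comm E)) ⟩
    ∑[ x < n ] ∑[ y < n ] E x y + ∑[ x < n ] ∑[ y < n ] E y x
      ≡⟨ trans (sum-cong-≗ (λ x → ∑-distrib-+ (E x) (λ y → E y x)))
               (∑-distrib-+ (λ x → ∑[ y < n ] E x y) (λ x → ∑[ y < n ] E y x)) ⟨
    ∑[ x < n ] ∑[ y < n ] (E x y + E y x)                ≡⟨ sum-cong-≗ (λ x → sum-cong-≗ (λ y → increasing-edges x y)) ⟩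
    ∑[ x < n ] ∑[ y < n ] 𝟙 (adj G x y)
      ≡⟨ sum-cong-≗ (λ x → sym (trans (+-identityʳ _) (sum-cong-≗ (λ y → +-identityʳ (𝟙 (adj G x y)))))) ⟩
    degSum full                                          ∎
    where
    open ≡-Reasoning
    E = increasing-edge
    count : edgeCount G ≡ ∑[ x < n ] ∑[ y < n ] E x y
    count = length-filter-cartesianProduct (λ (x , y) → (toℕ x <? toℕ y) ×-dec (adj G x y ≟ᵇ true)) (λ x → x) (λ y → y)

module MaximumClique {n} (G : Graph n) (noC4 : ¬ HasInducedC4 G) where

  open import Data.Bool using (Bool; true; false)
  open import Data.Nat
  open import Data.Nat.Properties
  open import Data.Fin using (Fin; zero)
  open import Data.List using (List; _∷_; length)
  open import Data.Product using (Σ-syntax; _×_; _,_; proj₁)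
  open import Data.Sum using (_⊎_; inj₁; inj₂)
  import Data.Sum as Sum
  open import Data.Empty using (⊥-elim)
  open import Relation.Nullary using (¬_; yes; no)
  open import Relation.Binary.PropositionalEquality
  open Finite
  open Graphs G

  edge-or-bound : ∀ S → CliqueIn S 2 ⊎ EdgeBound 1 S
  edge-or-bound S with sequence-⊎ (λ x → sequence-⊎ (λ y → edge x y))
    where
    edge : ∀ x y → (S x ≡ true → S y ≡ true → adj G x y ≡ false) ⊎ CliqueIn S 2
    edge x y with S x in Sx | S y in Sy | adj G x y in xy
    ... | true  | true  | true  = inj₂ (edge-clique Sx Sy xy)
    ... | true  | true  | false = inj₁ (λ _ _ → refl)
    ... | true  | false | _     = inj₁ (λ _ ())
    ... | false | _     | _     = inj₁ (λ ())
  ... | inj₂ clique = inj₁ clique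
  ... | inj₁ no-edge = inj₂ λ q U → subst (λ e → e * (q + U) * q ≤ _) (sym no-degree) z≤n
    where
    no-degree : degSum S ≡ 0
    no-degree = begin
      degSum S                   ≡⟨ ∑∈-cong S (λ x Sx → ∑∈-cong S (λ y Sy → cong 𝟙 (no-edge x y Sx Sy))) ⟩
      ∑[ x ∈ S ] ∑[ y ∈ S ] 0    ≡⟨ ∑∈-cong S (λ x _ → trans (∑∈-const S 0) (*-zeroʳ (size S))) ⟩
      ∑[ x ∈ S ] 0               ≡⟨ trans (∑∈-const S 0) (*-zeroʳ (size S)) ⟩
      0                          ∎
      where open ≡-Reasoning

  clique-or-bound-step : ∀ k T → (∀ w → T w ≡ true → 1 ≤ deg T w) →
    (∀ S → CliqueIn S (2 + k) ⊎ EdgeBound (1 + k) S) → CliqueIn T (3 + k) ⊎ EdgeBound (2 + k) T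
  clique-or-bound-step k T deg≥1 clique-or-bound
    with sequence-⊎ neighbourhood | sequence-⊎ (λ x → sequence-⊎ (codegree x))
    where
    neighbourhood : ∀ w → (T w ≡ true → EdgeBound (1 + k) (nbhd T w)) ⊎ CliqueIn T (3 + k)
    neighbourhood w with T w in Tw
    ... | false = inj₁ (λ ())
    ... | true with clique-or-bound (nbhd T w)
    ...   | inj₁ clique = inj₂ (clique-cons Tw clique)
    ...   | inj₂ bound = inj₁ (λ _ → bound)
    codegree : ∀ x y → (T x ≡ true → T y ≡ true → nonadj x y ≡ true → codeg T x y ≤ 1 + k) ⊎ CliqueIn T (3 + k)
    codegree x y with codeg T x y ≤? 1 + k
    ... | yes ≤k = inj₁ (λ _ _ _ → ≤k)
    ... | no ≰k with T x in Tx | T y in Ty | nonadj x y in x≁y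
    ...   | true  | true  | true  = inj₂ (common-nbhd-clique noC4 Tx Ty x≁y (≰⇒> ≰k))
    ...   | true  | true  | false = inj₁ (λ _ _ ())
    ...   | true  | false | _     = inj₁ (λ _ ())
    ...   | false | _     | _     = inj₁ (λ ())
  ... | inj₂ clique | _ = inj₁ clique
  ... | inj₁ _ | inj₂ clique = inj₁ clique
  ... | inj₁ bounds | inj₁ codegrees = inj₂ (EdgeBound-step (1 + k) T (s≤s z≤n) deg≥1 bounds codegrees)

  clique-or-bound : ∀ k S → CliqueIn S (2 + k) ⊎ EdgeBound (1 + k) S
  clique-or-bound zero = edge-or-bound
  clique-or-bound (suc k) S =
    Sum.map (clique-⊆ (nonIsolated-⊆ S)) (EdgeBound-nonIsolated (2 + k) S)
            (clique-or-bound-step k (nonIsolated S) (nonIsolated-deg≥1 S) (clique-or-bound k))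

  grow-clique : ∀ fuel (C : List (Fin n)) → IsClique G C → 1 ≤ length C → n ≤ length C + fuel →
    Σ[ D ∈ List (Fin n) ] IsClique G D × 1 ≤ length D × EdgeBound (length D) full
  grow-clique fuel (c ∷ C) clique _ n≤ with clique-or-bound (length C) full
  ... | inj₂ bound = c ∷ C , clique , s≤s z≤n , bound
  ... | inj₁ (D , D-clique , _ , longer) with fuel
  ...   | zero = ⊥-elim (<⇒≱ (≤-<-trans (subst (n ≤_) (+-identityʳ _) n≤) longer) (unique-length≤n (proj₁ D-clique)))
  ...   | suc f = grow-clique f D D-clique (≤-trans (s≤s z≤n) longer)
                    (≤-trans n≤ (subst (_≤ length D + f) (sym (+-suc (suc (length C)) f)) (+-monoˡ-≤ f longer)))

module Rationals where

  open import Data.Nat as ℕ using (ℕ; zero; suc; z≤n; s≤s)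
  import Data.Nat.Properties as ℕ
  open import Data.Nat.Combinatorics using (_C_; nC1≡n; nCk+nC[k+1]≡[n+1]C[k+1])
  open import Data.Nat.Coprimality using (1-coprimeTo)
  import Data.Nat.Coprimality as Coprimality
  open import Data.Nat.Tactic.RingSolver using (solve-∀)
  open import Data.Integer as ℤ using (+_; +≤+)
  import Data.Integer.Properties as ℤ
  open import Data.Rational using (ℚ; mkℚ; 0ℚ; 1ℚ; _<_; _≤_; _+_; _*_; _/_; *≤*; nonNegative; Positive)
  import Data.Rational.Properties as ℚ
  open import Data.Rational.Solver using (module +-*-Solver)
  open import Relation.Binary.PropositionalEquality
  open +-*-Solver

  private
    ℕ→ℚ≡mkℚ : ∀ a → ℕ→ℚ a ≡ mkℚ (+ a) 0 (Coprimality.sym (1-coprimeTo a))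
    ℕ→ℚ≡mkℚ a = ℚ.normalize-coprime (Coprimality.sym (1-coprimeTo a))

  ℕ→ℚ-+ : ∀ a b → ℕ→ℚ (a ℕ.+ b) ≡ ℕ→ℚ a + ℕ→ℚ b
  ℕ→ℚ-+ a b rewrite ℕ→ℚ≡mkℚ a | ℕ→ℚ≡mkℚ b =
    cong (_/ 1) (sym (cong₂ ℤ._+_ (ℤ.*-identityʳ (+ a)) (ℤ.*-identityʳ (+ b))))

  ℕ→ℚ-* : ∀ a b → ℕ→ℚ (a ℕ.* b) ≡ ℕ→ℚ a * ℕ→ℚ b
  ℕ→ℚ-* a b rewrite ℕ→ℚ≡mkℚ a | ℕ→ℚ≡mkℚ b = cong (_/ 1) (ℤ.pos-* a b)

  ℕ→ℚ-mono-≤ : ∀ {a b} → a ℕ.≤ b → ℕ→ℚ a ≤ ℕ→ℚ b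
  ℕ→ℚ-mono-≤ {a} {b} a≤b rewrite ℕ→ℚ≡mkℚ a | ℕ→ℚ≡mkℚ b =
    *≤* (subst₂ ℤ._≤_ (sym (ℤ.*-identityʳ (+ a))) (sym (ℤ.*-identityʳ (+ b))) (+≤+ a≤b))

  ℕ→ℚ-nonNeg : ∀ a → 0ℚ ≤ ℕ→ℚ a
  ℕ→ℚ-nonNeg a = ℕ→ℚ-mono-≤ {0} {a} z≤n

  *-nonNeg : ∀ {a b} → 0ℚ ≤ a → 0ℚ ≤ b → 0ℚ ≤ a * b
  *-nonNeg {a} {b} 0≤a 0≤b = subst (_≤ a * b) (ℚ.*-zeroˡ b) (ℚ.*-monoʳ-≤-nonNeg b {{nonNegative 0≤b}} 0≤a)

  square-mono : ∀ {a b} → 0ℚ ≤ a → a ≤ b → a * a ≤ b * b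
  square-mono {a} {b} 0≤a a≤b = ℚ.≤-trans (ℚ.*-monoˡ-≤-nonNeg a {{nonNegative 0≤a}} a≤b)
                                           (ℚ.*-monoʳ-≤-nonNeg b {{nonNegative (ℚ.≤-trans 0≤a a≤b)}} a≤b)

  2*[n+1]C2 : ∀ m → 2 ℕ.* (suc m C 2) ≡ suc m ℕ.* m
  2*[n+1]C2 zero = refl
  2*[n+1]C2 (suc m) = begin
    2 ℕ.* (suc (suc m) C 2)               ≡⟨ cong (2 ℕ.*_) (nCk+nC[k+1]≡[n+1]C[k+1] (suc m) 1) ⟨
    2 ℕ.* (suc m C 1 ℕ.+ suc m C 2)       ≡⟨ cong (λ c → 2 ℕ.* (c ℕ.+ suc m C 2)) (nC1≡n (suc m)) ⟩
    2 ℕ.* (suc m ℕ.+ suc m C 2)           ≡⟨ ℕ.*-distribˡ-+ 2 (suc m) (suc m C 2) ⟩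
    2 ℕ.* suc m ℕ.+ 2 ℕ.* (suc m C 2)     ≡⟨ cong (2 ℕ.* suc m ℕ.+_) (2*[n+1]C2 m) ⟩
    2 ℕ.* suc m ℕ.+ suc m ℕ.* m           ≡⟨ e m ⟩
    suc (suc m) ℕ.* suc m                 ∎
    where
    open ≡-Reasoning
    e : ∀ m → 2 ℕ.* suc m ℕ.+ suc m ℕ.* m ≡ suc (suc m) ℕ.* suc m
    e = solve-∀

  square-bound : ∀ α → 0ℚ ≤ α → ∀ m k e → α * ℕ→ℚ (suc m C 2) ≤ ℕ→ℚ e → 1 ℕ.≤ m →
    (2 ℕ.* e ℕ.+ k ℕ.* m) ℕ.* (2 ℕ.* e ℕ.+ k ℕ.* m) ℕ.≤ 4 ℕ.* k ℕ.* suc m ℕ.* (m ℕ.* m) →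
    (α * ℕ→ℚ (suc m) + ℕ→ℚ k) * (α * ℕ→ℚ (suc m) + ℕ→ℚ k) ≤ ℕ→ℚ 4 * ℕ→ℚ k * ℕ→ℚ (suc m)
  square-bound α 0≤α m@(suc _) k e edges _ square = ℚ.*-cancelʳ-≤-pos (M * M) {{M²-pos}} (begin
    A * A * (M * M)                        ≡⟨ solve 2 (λ a m → a :* a :* (m :* m) := (a :* m) :* (a :* m)) refl A M ⟩
    (A * M) * (A * M)                      ≤⟨ square-mono (*-nonNeg 0≤A (ℕ→ℚ-nonNeg m)) AM≤ ⟩
    ℕ→ℚ t * ℕ→ℚ t                          ≡⟨ ℕ→ℚ-* t t ⟨
    ℕ→ℚ (t ℕ.* t)                          ≤⟨ ℕ→ℚ-mono-≤ square ⟩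
    ℕ→ℚ (4 ℕ.* k ℕ.* suc m ℕ.* (m ℕ.* m))  ≡⟨ cast-4knm² ⟩
    ℕ→ℚ 4 * ℕ→ℚ k * N * (M * M)            ∎)
    where
    open ℚ.≤-Reasoning
    t = 2 ℕ.* e ℕ.+ k ℕ.* m
    N = ℕ→ℚ (suc m)
    M = ℕ→ℚ m
    A = α * N + ℕ→ℚ k
    cast-4knm² : ℕ→ℚ (4 ℕ.* k ℕ.* suc m ℕ.* (m ℕ.* m)) ≡ ℕ→ℚ 4 * ℕ→ℚ k * N * (M * M)
    cast-4knm² = trans (ℕ→ℚ-* (4 ℕ.* k ℕ.* suc m) (m ℕ.* m))
                       (cong₂ _*_ (trans (ℕ→ℚ-* (4 ℕ.* k) (suc m)) (cong (_* N) (ℕ→ℚ-* 4 k))) (ℕ→ℚ-* m m))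
    M²-pos : Positive (M * M)
    M²-pos rewrite sym (ℕ→ℚ-* m m) | ℕ→ℚ≡mkℚ (m ℕ.* m) = _
    0≤A : 0ℚ ≤ A
    0≤A = ℚ.+-mono-≤ (*-nonNeg 0≤α (ℕ→ℚ-nonNeg (suc m))) (ℕ→ℚ-nonNeg k)
    αnm≤2e : α * ℕ→ℚ (suc m ℕ.* m) ≤ ℕ→ℚ (2 ℕ.* e)
    αnm≤2e = subst₂ _≤_ (trans (solve 3 (λ a t c → t :* (a :* c) := a :* (t :* c)) refl α (ℕ→ℚ 2) (ℕ→ℚ (suc m C 2)))
                               (cong (α *_) (trans (sym (ℕ→ℚ-* 2 (suc m C 2))) (cong ℕ→ℚ (2*[n+1]C2 m)))))
                        (sym (ℕ→ℚ-* 2 e))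
                        (ℚ.*-monoˡ-≤-nonNeg (ℕ→ℚ 2) {{nonNegative (ℕ→ℚ-nonNeg 2)}} edges)
    AM≤ : A * M ≤ ℕ→ℚ t
    AM≤ = subst₂ _≤_ (trans (cong₂ _+_ (cong (α *_) (ℕ→ℚ-* (suc m) m)) (ℕ→ℚ-* k m))
                            (solve 4 (λ a n m k → a :* (n :* m) :+ k :* m := (a :* n :+ k) :* m) refl α N M (ℕ→ℚ k)))
                     (sym (ℕ→ℚ-+ (2 ℕ.* e) (k ℕ.* m)))
                     (ℚ.+-monoˡ-≤ (ℕ→ℚ (k ℕ.* m)) αnm≤2e)

  clique-bound : ∀ α → 0ℚ < α → α ≤ 1ℚ → ∀ m k e → α * ℕ→ℚ (suc m C 2) ≤ ℕ→ℚ e →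
    1 ℕ.≤ k → k ℕ.≤ suc m →
    (2 ℕ.* e ℕ.+ k ℕ.* m) ℕ.* (2 ℕ.* e ℕ.+ k ℕ.* m) ℕ.≤ 4 ℕ.* k ℕ.* suc m ℕ.* (m ℕ.* m) →
    (α * ℕ→ℚ (suc m) + ℕ→ℚ k) * (α * ℕ→ℚ (suc m) + ℕ→ℚ k) ≤ ℕ→ℚ 4 * ℕ→ℚ k * ℕ→ℚ (suc m)
  clique-bound α 0<α α≤1 zero (suc zero) _ _ _ _ _ =
    square-mono (ℚ.+-mono-≤ (*-nonNeg (ℚ.<⇒≤ 0<α) (ℕ→ℚ-nonNeg 1)) (ℕ→ℚ-nonNeg 1))
                (ℚ.+-monoˡ-≤ (ℕ→ℚ 1) (subst (_≤ 1ℚ) (sym (ℚ.*-identityʳ α)) α≤1))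
  clique-bound _ _ _ zero zero _ _ () _ _
  clique-bound _ _ _ zero (suc (suc _)) _ _ _ (s≤s ()) _
  clique-bound α 0<α α≤1 (suc m) k e edges _ _ square =
    square-bound α (ℚ.<⇒≤ 0<α) (suc m) k e edges (s≤s z≤n) square

  no-vertices : ∀ α → (α * ℕ→ℚ 0 + ℕ→ℚ 0) * (α * ℕ→ℚ 0 + ℕ→ℚ 0) ≤ ℕ→ℚ 4 * ℕ→ℚ 0 * ℕ→ℚ 0
  no-vertices α rewrite ℚ.*-zeroʳ α = ℚ.≤-refl

module _ {m} (G : Graph (suc m)) (noC4 : ¬ HasInducedC4 G) where

  open import Data.Nat
  open import Data.Nat.Properties using (≤-refl)
  open import Data.Fin using (Fin; zero)
  open import Data.List using (List; []; _∷_)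
  open import Data.List.Relation.Unary.All using ([])
  open import Data.List.Relation.Unary.AllPairs using ([]; _∷_)
  open import Data.Product using (Σ-syntax; _,_; proj₁)
  open import Relation.Binary.PropositionalEquality
  open Finite using (size-full; unique-length≤n)
  open Arithmetic using (edge-bound-optimised)
  open Graphs G using (2*edgeCount≡degSum)
  open MaximumClique G noC4 using (grow-clique)

  large-clique : Σ[ xs ∈ List (Fin (suc m)) ] IsClique G xs × 1 ≤ length xs × length xs ≤ suc m ×
    (2 * edgeCount G + length xs * m) * (2 * edgeCount G + length xs * m) ≤ 4 * length xs * suc m * (m * m)
  large-clique with grow-clique m (zero ∷ []) ([] ∷ [] , [] ∷ []) (s≤s z≤n) ≤-refl
  ... | xs , clique , 1≤k , bound =
    xs , clique , 1≤k , k≤n , edge-bound-optimised (length xs) m (2 * edgeCount G) 1≤k k≤n bound′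
    where
    k≤n = unique-length≤n (proj₁ clique)
    bound′ : ∀ q U → 2 * edgeCount G * (q + U) * q ≤ m * (length xs * U * (q + U) + suc m * q * q)
    bound′ q U = subst₂ (λ X N → X * (q + U) * q ≤ (N ∸ 1) * (length xs * U * (q + U) + N * q * q))
                        (sym 2*edgeCount≡degSum) (size-full (suc m)) (bound q U)

open import Data.Nat.Combinatorics using (_C_)
open import Data.List using ([])
open import Data.List.Relation.Unary.AllPairs using ([])
open import Data.Product using (_,_)
open import Data.Rational using (ℚ; 0ℚ; 1ℚ; _<_; _≤_; _+_; _*_)

theorem1 : (α : ℚ) → 0ℚ < α → α ≤ 1ℚ →
    (n : ℕ) (G : Graph n) →
    α * ℕ→ℚ (n C 2) ≤ ℕ→ℚ (edgeCount G) →
    ¬ HasInducedC4 G →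
    Σ _ λ xs → IsClique G xs ×
      ((α * ℕ→ℚ n + ℕ→ℚ (length xs)) * (α * ℕ→ℚ n + ℕ→ℚ (length xs))
        ≤ ℕ→ℚ 4 * ℕ→ℚ (length xs) * ℕ→ℚ n)
theorem1 α 0<α α≤1 zero G _ _ = [] , ([] , []) , Rationals.no-vertices α
theorem1 α 0<α α≤1 (suc m) G dense noC4 with large-clique G noC4
... | xs , clique , 1≤k , k≤n , square =
  xs , clique , Rationals.clique-bound α 0<α α≤1 m (length xs) (edgeCount G) dense 1≤k k≤n square
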